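{- Let $(1,P)$ be a Minsky machine with $n$ registers and no self loops. Then for every $\vec v\in\mathbb N^n$, $(1,P)$ terminates from $(1,\vec v)$ if and only if the FRACTRAN program $\overline{(1,P)}$ terminates from $\overline{(1,\vec v)}$.
   Context: Minsky machines. An instruction over $n$ registers is $\mathrm{INC}\,\alpha$ or $\mathrm{DEC}\,\alpha\,p$ with $\alpha<n$ and $p\in\mathbb N$. A machine $(s,[\iota_0;\dots;\iota_k])$ has $\iota_j$ at label $s+j$. A state is $(i,\vec v)$. If $i$ labels an instruction, one step is as follows. - $\mathrm{INC}\,\alpha$ goes to $(i+1,\vec v[\alpha\mapsto v_\alpha+1])$. - $\mathrm{DEC}\,\alpha\,p$ goes to $(i+1,\vec v[\alpha\mapsto v_\alpha-1])$ if $v_\alpha>0$, and to $(p,\vec v)$ if $v_\alpha=0$. A machine terminates from a state if, after finitely many steps, it reaches a state with program counter outside the code. A self loop is an instruction $\mathrm{DEC}\,\alpha\,i$ at label $i$. FRACTRAN. A program is a list of pairs $(p,q)\in\mathbb N^2$, written $p/q$. The step relation $Q:x\succ y$ is defined inductively. - $(p/q::Q'):x\succ y$ if $qy=px$. - $(p/q::Q'):x\succ y$ if $q\nmid px$ and $Q':x\succ y$. $Q$ terminates from $s$ if some $x$ reachable from $s$ in finitely many steps admits no $y$ with $Q:x\succ y$. Encoding. Fix two sequences of primes $\mathfrak p_0,\mathfrak p_1,\dots$ and $\mathfrak q_0,\mathfrak q_1,\dots$, all pairwise distinct. - A state is encoded as $\overline{(i,\vec v)}=\mathfrak p_i\,\mathfrak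 q_0^{v_0}\cdots\mathfrak q_{n-1}^{v_{n-1}}$. - An instruction at label $i$ is encoded as $\overline{(i,\mathrm{INC}\,\alpha)}=[\mathfrak p_{i+1}\mathfrak q_\alpha/\mathfrak p_i]$ and $\overline{(i,\mathrm{DEC}\,\alpha\,j)}=[\mathfrak p_{i+1}/(\mathfrak p_i\mathfrak q_\alpha);\ \mathfrak p_j/\mathfrak p_i]$. - A program is encoded as $\overline{(i,[\iota_0;\dots;\iota_k])}=\overline{(i,\iota_0)}\,{+\!\!+}\cdots{+\!\!+}\,\overline{(i+k,\iota_k)}$ (list concatenation). -}

module Defs where

open import Data.Nat using (ℕ; zero; suc; _+_; _*_; _∸_; _^_; _≤_; _<_; _≟_; _<ᵇ_)
open import Data.Nat.Divisibility using (_∣_)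
open import Data.Nat.Primality using (Prime)
open import Data.Fin using (Fin; toℕ)
open import Data.Vec using (Vec; []; _∷_; lookup; _[_]≔_)
open import Data.List using (List; []; _∷_; _++_)
open import Data.Maybe using (Maybe; just; nothing)
open import Data.Product using (Σ; ∃; _×_; _,_)
open import Data.Bool using (if_then_else_)
open import Relation.Nullary using (¬_)
open import Relation.Binary.PropositionalEquality using (_≡_)
open import Relation.Binary.Construct.Closure.ReflexiveTransitive using (Star)

data Instr (n : ℕ) : Set where
  INC : Fin n → Instr n
  DEC : Fin n → ℕ → Instr n

-- A machine (s , [ι₀ ; … ; ιₖ]) : ιⱼ is at label s + j
Machine : ℕ → Set
Machine n = ℕ × List (Instr n)

State : ℕ → Set
State n = ℕ × Vec ℕ n

instrAt : ∀ {n} → ℕ → List (Instr n) → ℕ → Maybe (Instr n)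
instrAt s [] i = nothing
instrAt s (ι ∷ P) i with i ≟ s
... | Relation.Nullary.yes _ = just ι
... | Relation.Nullary.no _ = instrAt (suc s) P i

data MStep {n : ℕ} (M : Machine n) : State n → State n → Set where
  inc : ∀ {i α v} → instrAt (Data.Product.proj₁ M) (Data.Product.proj₂ M) i ≡ just (INC α) →
        MStep M (i , v) (suc i , v [ α ]≔ suc (lookup v α))
  dec-suc : ∀ {i α p v m} → instrAt (Data.Product.proj₁ M) (Data.Product.proj₂ M) i ≡ just (DEC α p) →
        lookup v α ≡ suc m →
        MStep M (i , v) (suc i , v [ α ]≔ m)
  dec-zero : ∀ {i α p v} → instrAt (Data.Product.proj₁ M) (Data.Product.proj₂ M) i ≡ just (DEC α p) →
        lookup v α ≡ 0 →
        MStep M (i , v) (p , v)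

MTerminates : ∀ {n} → Machine n → State n → Set
MTerminates {n} M st =
  Σ (State n) λ st' → Star (MStep M) st st' ×
    instrAt (Data.Product.proj₁ M) (Data.Product.proj₂ M) (Data.Product.proj₁ st') ≡ nothing

NoSelfLoops : ∀ {n} → Machine n → Set
NoSelfLoops M = ∀ i α → ¬ (instrAt (Data.Product.proj₁ M) (Data.Product.proj₂ M) i ≡ just (DEC α i))

Fractran : Set
Fractran = List (ℕ × ℕ)   -- (p , q) stands for p / q

data FStep : Fractran → ℕ → ℕ → Set where
  here : ∀ {p q Q x y} → q * y ≡ p * x → FStep ((p , q) ∷ Q) x y
  there : ∀ {p q Q x y} → ¬ (q ∣ p * x) → FStep Q x y → FStep ((p , q) ∷ Q) x y

FTerminates : Fractran → ℕ → Set
FTerminates Q s = Σ ℕ λ x → Star (FStep Q) s x × (∀ y → ¬ FStep Q x y)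

regCode : (𝔮 : ℕ → ℕ) → ∀ {n} → Vec ℕ n → ℕ
regCode 𝔮 [] = 1
regCode 𝔮 (x ∷ v) = 𝔮 0 ^ x * regCode (λ k → 𝔮 (suc k)) v

encState : (𝔭 𝔮 : ℕ → ℕ) → ∀ {n} → State n → ℕ
encState 𝔭 𝔮 (i , v) = 𝔭 i * regCode 𝔮 v

encInstr : (𝔭 𝔮 : ℕ → ℕ) → ∀ {n} → ℕ → Instr n → Fractran
encInstr 𝔭 𝔮 i (INC α)   = (𝔭 (suc i) * 𝔮 (toℕ α) , 𝔭 i) ∷ []
encInstr 𝔭 𝔮 i (DEC α j) = (𝔭 (suc i) , 𝔭 i * 𝔮 (toℕ α)) ∷ (𝔭 j , 𝔭 i) ∷ []

encProg : (𝔭 𝔮 : ℕ → ℕ) → ∀ {n} → ℕ → List (Instr n) → Fractran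
encProg 𝔭 𝔮 i [] = []
encProg 𝔭 𝔮 i (ι ∷ P) = encInstr 𝔭 𝔮 i ι ++ encProg 𝔭 𝔮 (suc i) P

encMachine : (𝔭 𝔮 : ℕ → ℕ) → ∀ {n} → Machine n → Fractran
encMachine 𝔭 𝔮 (s , P) = encProg 𝔭 𝔮 s P

PrimeSeqs : (𝔭 𝔮 : ℕ → ℕ) → Set
PrimeSeqs 𝔭 𝔮 =
  (∀ i → Prime (𝔭 i)) × (∀ i → Prime (𝔮 i)) ×
  (∀ i j → 𝔭 i ≡ 𝔭 j → i ≡ j) × (∀ i j → 𝔮 i ≡ 𝔮 j → i ≡ j) ×
  (∀ i j → ¬ (𝔭 i ≡ 𝔮 j))

-- The fractions of the instruction at label j are the only ones whose denominator contains 𝔭 j,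
-- and an encoded state at label i contains no 𝔭 j for j ≠ i. Hence on an encoded state at
-- label i every fraction of another label is inapplicable, and the encoded program performs
-- exactly the encoded step of the instruction at i; at a halting label no fraction applies.
-- The one exception would be a self loop DEC α j at label j, whose second fraction 𝔭 j / 𝔭 j
-- applies to every number. So the FRACTRAN program simulates the machine step by step and is
-- stuck exactly where the machine halts; since FRACTRAN is deterministic, its termination
-- transfers back to the machine.
module Submission where

open import Defs
open import Data.Nat using (ℕ; zero; suc; _*_; _^_; _<_; _≟_; ≢-nonZero; ≢-nonZero⁻¹; nonTrivial⇒≢1)
open import Data.Nat.Properties using (1+n≢n; ≤-refl; <-irrefl; m<n⇒m<1+n; *-cancelˡ-≡; *-assoc; m*n≢0)
open import Data.Nat.Divisibility using (_∣_; ∣1⇒≡1; m∣m*n; m*n∣⇒m∣; m*n∣⇒n∣)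
open import Data.Nat.Primality using (Prime; euclidsLemma; prime⇒irreducible; prime⇒nonZero; prime⇒nonTrivial)
open import Data.Nat.Tactic.RingSolver using (solve-∀)
open import Data.Fin using (Fin; toℕ) renaming (zero to fzero; suc to fsuc)
open import Data.Fin.Properties using (toℕ-injective)
open import Data.Vec using (Vec; []; _∷_; lookup; _[_]≔_)
open import Data.Vec.Properties using ([]≔-lookup)
open import Data.List using (List; []; _∷_; _++_)
open import Data.List.Relation.Unary.All using (All; []; _∷_)
open import Data.List.Relation.Unary.All.Properties using (++⁺)
open import Data.Maybe using (just; nothing)
open import Data.Product using (Σ; _×_; _,_; proj₁; proj₂)
open import Data.Sum using (_⊎_; inj₁; inj₂)
open import Data.Empty using (⊥-elim)
open import Relation.Nullary using (¬_; yes; no)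
open import Relation.Binary.PropositionalEquality
open import Relation.Binary.Construct.Closure.ReflexiveTransitive using (Star; ε; _◅_; gmap)
open import Function.Bundles using (_⇔_; mk⇔)

module _ {A B : Set} {_⟶_ : A → A → Set} {_↝_ : B → B → Set} {Halted : A → Set}
         (enc : A → B)
         (simulate : ∀ {a a′} → a ⟶ a′ → enc a ↝ enc a′)
         (progress : ∀ a → Halted a ⊎ Σ A (a ⟶_))
         (↝-deterministic : ∀ {b b₁ b₂} → b ↝ b₁ → b ↝ b₂ → b₁ ≡ b₂)
         where

  simulation-reflects-halting : ∀ a {b} → Star _↝_ (enc a) b → (∀ b′ → ¬ b ↝ b′) →
    Σ A λ a′ → Star _⟶_ a a′ × Halted a′
  simulation-reflects-halting a steps stuck with progress a
  ... | inj₁ halted = a , ε , halted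
  ... | inj₂ (a₁ , a⟶a₁) with steps
  ...   | ε = ⊥-elim (stuck _ (simulate a⟶a₁))
  ...   | step ◅ steps′ rewrite ↝-deterministic step (simulate a⟶a₁) =
          let a′ , a₁⟶*a′ , halted = simulation-reflects-halting a₁ steps′ stuck
          in  a′ , a⟶a₁ ◅ a₁⟶*a′ , halted

Blocked : ℕ → Fractran → Set
Blocked x = All λ (p , q) → ¬ q ∣ p * x

m*n≡o⇒m∣o : ∀ {m o} n → m * n ≡ o → m ∣ o
m*n≡o⇒m∣o n eq = subst (_ ∣_) eq (m∣m*n n)

blocked⇒¬FStep : ∀ {Q x y} → Blocked x Q → ¬ FStep Q x y
blocked⇒¬FStep (q∤ ∷ _) (here {y = y} eq) = q∤ (m*n≡o⇒m∣o y eq)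
blocked⇒¬FStep (_ ∷ bl) (there _ st)      = blocked⇒¬FStep bl st

FStep-++ˡ : ∀ {Q Q′ x y} → FStep Q x y → FStep (Q ++ Q′) x y
FStep-++ˡ (here eq)     = here eq
FStep-++ˡ (there q∤ st) = there q∤ (FStep-++ˡ st)

FStep-++ʳ : ∀ {Q Q′ x y} → Blocked x Q → FStep Q′ x y → FStep (Q ++ Q′) x y
FStep-++ʳ []        st = st
FStep-++ʳ (q∤ ∷ bl) st = there q∤ (FStep-++ʳ bl st)

FStep-deterministic : ∀ {Q x y y′} → All (λ (_ , q) → q ≢ 0) Q → FStep Q x y → FStep Q x y′ → y ≡ y′
FStep-deterministic (q≢0 ∷ _) (here {q = q} {y = y} eq) (here {y = y′} eq′) =
  *-cancelˡ-≡ y y′ q {{≢-nonZero q≢0}} (trans eq (sym eq′))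
FStep-deterministic (_ ∷ _)  (here {y = y} eq) (there q∤ _)      = ⊥-elim (q∤ (m*n≡o⇒m∣o y eq))
FStep-deterministic (_ ∷ _)  (there q∤ _)      (here {y = y} eq) = ⊥-elim (q∤ (m*n≡o⇒m∣o y eq))
FStep-deterministic (_ ∷ nz) (there _ st)      (there _ st′)     = FStep-deterministic nz st st′

prime≢0 : ∀ {r} → Prime r → r ≢ 0
prime≢0 {r} pr = ≢-nonZero⁻¹ r {{prime⇒nonZero pr}}

prime≢1 : ∀ {r} → Prime r → r ≢ 1
prime≢1 pr = nonTrivial⇒≢1 {{prime⇒nonTrivial pr}}

prime∤1 : ∀ {r} → Prime r → ¬ r ∣ 1
prime∤1 pr r∣1 = prime≢1 pr (∣1⇒≡1 r∣1)

prime∣prime⇒≡ : ∀ {r s} → Prime r → Prime s → r ∣ s → r ≡ s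
prime∣prime⇒≡ pr ps r∣s with prime⇒irreducible ps r∣s
... | inj₁ r≡1 = ⊥-elim (prime≢1 pr r≡1)
... | inj₂ r≡s = r≡s

prime∤* : ∀ {r m n} → Prime r → ¬ r ∣ m → ¬ r ∣ n → ¬ r ∣ m * n
prime∤* {m = m} {n} pr r∤m r∤n r∣mn with euclidsLemma m n pr r∣mn
... | inj₁ r∣m = r∤m r∣m
... | inj₂ r∣n = r∤n r∣n

prime∣^⇒∣ : ∀ {r} a x → Prime r → r ∣ a ^ x → x ≢ 0 × r ∣ a
prime∣^⇒∣ a zero    pr r∣1 = ⊥-elim (prime∤1 pr r∣1)
prime∣^⇒∣ a (suc x) pr r∣a^1+x with euclidsLemma a (a ^ x) pr r∣a^1+x
... | inj₁ r∣a   = (λ ()) , r∣a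
... | inj₂ r∣a^x = (λ ()) , proj₂ (prime∣^⇒∣ a x pr r∣a^x)

prime∣regCode : ∀ {r} (𝔮 : ℕ → ℕ) {n} (v : Vec ℕ n) → Prime r → r ∣ regCode 𝔮 v →
  Σ (Fin n) λ α → lookup v α ≢ 0 × r ∣ 𝔮 (toℕ α)
prime∣regCode 𝔮 []      pr r∣1 = ⊥-elim (prime∤1 pr r∣1)
prime∣regCode 𝔮 (x ∷ v) pr r∣code with euclidsLemma (𝔮 0 ^ x) (regCode (λ k → 𝔮 (suc k)) v) pr r∣code
... | inj₁ r∣𝔮₀^x = fzero , prime∣^⇒∣ (𝔮 0) x pr r∣𝔮₀^x
... | inj₂ r∣rest =
  let α , vα≢0 , r∣𝔮α = prime∣regCode (λ k → 𝔮 (suc k)) v pr r∣rest in fsuc α , vα≢0 , r∣𝔮α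

regCode-[]≔suc : (𝔮 : ℕ → ℕ) → ∀ {n} (v : Vec ℕ n) α m →
  regCode 𝔮 (v [ α ]≔ suc m) ≡ regCode 𝔮 (v [ α ]≔ m) * 𝔮 (toℕ α)
regCode-[]≔suc 𝔮 (x ∷ v) fzero    m = rotate (𝔮 0) (𝔮 0 ^ m) (regCode (λ k → 𝔮 (suc k)) v)
  where rotate : ∀ a b c → (a * b) * c ≡ (b * c) * a
        rotate = solve-∀
regCode-[]≔suc 𝔮 (x ∷ v) (fsuc α) m =
  trans (cong (𝔮 0 ^ x *_) (regCode-[]≔suc (λ k → 𝔮 (suc k)) v α m)) (sym (*-assoc (𝔮 0 ^ x) _ _))

regCode-inc : (𝔮 : ℕ → ℕ) → ∀ {n} (v : Vec ℕ n) α →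
  regCode 𝔮 (v [ α ]≔ suc (lookup v α)) ≡ regCode 𝔮 v * 𝔮 (toℕ α)
regCode-inc 𝔮 v α =
  trans (regCode-[]≔suc 𝔮 v α (lookup v α)) (cong (λ w → regCode 𝔮 w * 𝔮 (toℕ α)) ([]≔-lookup v α))

regCode-dec : (𝔮 : ℕ → ℕ) → ∀ {n} (v : Vec ℕ n) α {m} → lookup v α ≡ suc m →
  regCode 𝔮 (v [ α ]≔ m) * 𝔮 (toℕ α) ≡ regCode 𝔮 v
regCode-dec 𝔮 v α {m} vα≡1+m = begin
  regCode 𝔮 (v [ α ]≔ m) * 𝔮 (toℕ α) ≡⟨ regCode-[]≔suc 𝔮 v α m ⟨
  regCode 𝔮 (v [ α ]≔ suc m)          ≡⟨ cong (λ x → regCode 𝔮 (v [ α ]≔ x)) vα≡1+m ⟨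
  regCode 𝔮 (v [ α ]≔ lookup v α)     ≡⟨ cong (regCode 𝔮) ([]≔-lookup v α) ⟩
  regCode 𝔮 v                          ∎
  where open ≡-Reasoning

instrAt-here : ∀ {n} s (ι : Instr n) P → instrAt s (ι ∷ P) s ≡ just ι
instrAt-here s ι P with s ≟ s
... | yes _   = refl
... | no s≢s = ⊥-elim (s≢s refl)

instrAt-there : ∀ {n} {s i} (ι : Instr n) P → i ≢ s → instrAt s (ι ∷ P) i ≡ instrAt (suc s) P i
instrAt-there {s = s} {i} ι P i≢s with i ≟ s
... | yes i≡s = ⊥-elim (i≢s i≡s)
... | no _    = refl

instrAt-< : ∀ {n} s (P : List (Instr n)) i → i < s → instrAt s P i ≡ nothing
instrAt-< s []      i i<s = refl
instrAt-< s (ι ∷ P) i i<s with i ≟ s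
... | yes refl = ⊥-elim (<-irrefl refl i<s)
... | no _     = instrAt-< (suc s) P i (m<n⇒m<1+n i<s)

noSelfLoop-here : ∀ {n s} {ι : Instr n} {P} → NoSelfLoops (s , ι ∷ P) → ∀ α → ι ≢ DEC α s
noSelfLoop-here {s = s} {ι} {P} nsl α ι≡loop = nsl s α (trans (instrAt-here s ι P) (cong just ι≡loop))

noSelfLoops-tail : ∀ {n s} {ι : Instr n} {P} → NoSelfLoops (s , ι ∷ P) → NoSelfLoops (suc s , P)
noSelfLoops-tail {s = s} {ι} {P} nsl i α loop with i ≟ s
... | yes refl with () ← trans (sym (instrAt-< (suc i) P i ≤-refl)) loop
... | no i≢s   = nsl i α (trans (instrAt-there ι P i≢s) loop)

module Encoding (𝔭 𝔮 : ℕ → ℕ) (primes : PrimeSeqs 𝔭 𝔮) {n : ℕ} where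

  𝔭-prime : ∀ i → Prime (𝔭 i)
  𝔭-prime = proj₁ primes

  𝔮-prime : ∀ i → Prime (𝔮 i)
  𝔮-prime = proj₁ (proj₂ primes)

  𝔭-injective : ∀ i j → 𝔭 i ≡ 𝔭 j → i ≡ j
  𝔭-injective = proj₁ (proj₂ (proj₂ primes))

  𝔮-injective : ∀ i j → 𝔮 i ≡ 𝔮 j → i ≡ j
  𝔮-injective = proj₁ (proj₂ (proj₂ (proj₂ primes)))

  𝔭≢𝔮 : ∀ i j → 𝔭 i ≢ 𝔮 j
  𝔭≢𝔮 = proj₂ (proj₂ (proj₂ (proj₂ primes)))

  R : Vec ℕ n → ℕ
  R = regCode 𝔮

  𝔭∤𝔭 : ∀ {j k} → j ≢ k → ¬ 𝔭 j ∣ 𝔭 k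
  𝔭∤𝔭 {j} {k} j≢k 𝔭j∣𝔭k = j≢k (𝔭-injective j k (prime∣prime⇒≡ (𝔭-prime j) (𝔭-prime k) 𝔭j∣𝔭k))

  𝔭∤𝔮 : ∀ {j k} → ¬ 𝔭 j ∣ 𝔮 k
  𝔭∤𝔮 {j} {k} 𝔭j∣𝔮k = 𝔭≢𝔮 j k (prime∣prime⇒≡ (𝔭-prime j) (𝔮-prime k) 𝔭j∣𝔮k)

  𝔮∤𝔭 : ∀ {j k} → ¬ 𝔮 k ∣ 𝔭 j
  𝔮∤𝔭 {j} {k} 𝔮k∣𝔭j = 𝔭≢𝔮 j k (sym (prime∣prime⇒≡ (𝔮-prime k) (𝔭-prime j) 𝔮k∣𝔭j))

  𝔭∤R : ∀ {j} (v : Vec ℕ n) → ¬ 𝔭 j ∣ R v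
  𝔭∤R {j} v 𝔭j∣Rv = let _ , _ , 𝔭j∣𝔮α = prime∣regCode 𝔮 v (𝔭-prime j) 𝔭j∣Rv in 𝔭∤𝔮 𝔭j∣𝔮α

  𝔮∤R : ∀ (v : Vec ℕ n) α → lookup v α ≡ 0 → ¬ 𝔮 (toℕ α) ∣ R v
  𝔮∤R v α vα≡0 𝔮α∣Rv with prime∣regCode 𝔮 v (𝔮-prime (toℕ α)) 𝔮α∣Rv
  ... | β , vβ≢0 , 𝔮α∣𝔮β with toℕ-injective (𝔮-injective _ _
                                 (prime∣prime⇒≡ (𝔮-prime (toℕ α)) (𝔮-prime (toℕ β)) 𝔮α∣𝔮β))
  ...   | refl = vβ≢0 vα≡0

  𝔭∤enc : ∀ {a j i} (v : Vec ℕ n) → ¬ 𝔭 j ∣ a → j ≢ i → ¬ 𝔭 j ∣ a * (𝔭 i * R v)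
  𝔭∤enc v 𝔭j∤a j≢i = prime∤* (𝔭-prime _) 𝔭j∤a (prime∤* (𝔭-prime _) (𝔭∤𝔭 j≢i) (𝔭∤R v))

  -- Every denominator of encInstr j ι contains 𝔭 j, while the numerators avoid 𝔭 j unless ι
  -- jumps to j.
  encInstr-blocked : ∀ {j i} (ι : Instr n) (v : Vec ℕ n) → j ≢ i → (∀ α → ι ≢ DEC α j) →
    Blocked (𝔭 i * R v) (encInstr 𝔭 𝔮 j ι)
  encInstr-blocked {j} (INC α) v j≢i _ =
    𝔭∤enc v (prime∤* (𝔭-prime j) (𝔭∤𝔭 (≢-sym 1+n≢n)) 𝔭∤𝔮) j≢i ∷ []
  encInstr-blocked {j} (DEC α k) v j≢i notLoop =
    (λ 𝔭j𝔮α∣ → 𝔭∤enc v (𝔭∤𝔭 (≢-sym 1+n≢n)) j≢i (m*n∣⇒m∣ (𝔭 j) (𝔮 (toℕ α)) 𝔭j𝔮α∣))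
    ∷ 𝔭∤enc v (𝔭∤𝔭 (λ j≡k → notLoop α (cong (DEC α) (sym j≡k)))) j≢i ∷ []

  encProg-blocked : ∀ s P {i} (v : Vec ℕ n) → NoSelfLoops (s , P) → instrAt s P i ≡ nothing →
    Blocked (𝔭 i * R v) (encProg 𝔭 𝔮 s P)
  encProg-blocked s []      v nsl _ = []
  encProg-blocked s (ι ∷ P) {i} v nsl halts with i ≟ s
  ... | yes refl with () ← halts
  ... | no i≢s = ++⁺ (encInstr-blocked ι v (≢-sym i≢s) (noSelfLoop-here nsl))
                     (encProg-blocked (suc s) P v (noSelfLoops-tail nsl) halts)

  encProg-step : ∀ s P {i ι y} (v : Vec ℕ n) → NoSelfLoops (s , P) → instrAt s P i ≡ just ι →
    FStep (encInstr 𝔭 𝔮 i ι) (𝔭 i * R v) y → FStep (encProg 𝔭 𝔮 s P) (𝔭 i * R v) y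
  encProg-step s []      v nsl () _
  encProg-step s (κ ∷ P) {i} v nsl at-i st with i ≟ s
  ... | yes refl with refl ← at-i = FStep-++ˡ st
  ... | no i≢s = FStep-++ʳ (encInstr-blocked κ v (≢-sym i≢s) (noSelfLoop-here nsl))
                           (encProg-step (suc s) P v (noSelfLoops-tail nsl) at-i st)

  encInstr-inc : ∀ i (v : Vec ℕ n) α →
    FStep (encInstr 𝔭 𝔮 i (INC α)) (𝔭 i * R v) (𝔭 (suc i) * R (v [ α ]≔ suc (lookup v α)))
  encInstr-inc i v α = here (begin
    𝔭 i * (𝔭 (suc i) * R (v [ α ]≔ suc (lookup v α))) ≡⟨ cong (λ x → 𝔭 i * (𝔭 (suc i) * x)) (regCode-inc 𝔮 v α) ⟩
    𝔭 i * (𝔭 (suc i) * (R v * q))                     ≡⟨ shuffle (𝔭 i) (𝔭 (suc i)) (R v) q ⟩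
    𝔭 (suc i) * q * (𝔭 i * R v)                       ∎)
    where open ≡-Reasoning
          q = 𝔮 (toℕ α)
          shuffle : ∀ a b c d → a * (b * (c * d)) ≡ b * d * (a * c)
          shuffle = solve-∀

  encInstr-dec-suc : ∀ i (v : Vec ℕ n) α p {m} → lookup v α ≡ suc m →
    FStep (encInstr 𝔭 𝔮 i (DEC α p)) (𝔭 i * R v) (𝔭 (suc i) * R (v [ α ]≔ m))
  encInstr-dec-suc i v α p {m} vα≡1+m = here (begin
    𝔭 i * q * (𝔭 (suc i) * R w)         ≡⟨ shuffle (𝔭 i) q (𝔭 (suc i)) (R w) ⟩
    𝔭 (suc i) * (𝔭 i * (R w * q))       ≡⟨ cong (λ x → 𝔭 (suc i) * (𝔭 i * x)) (regCode-dec 𝔮 v α vα≡1+m) ⟩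
    𝔭 (suc i) * (𝔭 i * R v)             ∎)
    where open ≡-Reasoning
          q = 𝔮 (toℕ α)
          w = v [ α ]≔ m
          shuffle : ∀ a b c d → a * b * (c * d) ≡ c * (a * (d * b))
          shuffle = solve-∀

  encInstr-dec-zero : ∀ i (v : Vec ℕ n) α p → lookup v α ≡ 0 →
    FStep (encInstr 𝔭 𝔮 i (DEC α p)) (𝔭 i * R v) (𝔭 p * R v)
  encInstr-dec-zero i v α p vα≡0 = there 𝔭i𝔮α∤ (here (swap (𝔭 i) (𝔭 p) (R v)))
    where
      swap : ∀ a b c → a * (b * c) ≡ b * (a * c)
      swap = solve-∀
      𝔮α∤ : ¬ 𝔮 (toℕ α) ∣ 𝔭 (suc i) * (𝔭 i * R v)
      𝔮α∤ = prime∤* (𝔮-prime _) 𝔮∤𝔭 (prime∤* (𝔮-prime _) 𝔮∤𝔭 (𝔮∤R v α vα≡0))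
      𝔭i𝔮α∤ : ¬ 𝔭 i * 𝔮 (toℕ α) ∣ 𝔭 (suc i) * (𝔭 i * R v)
      𝔭i𝔮α∤ 𝔭i𝔮α∣ = 𝔮α∤ (m*n∣⇒n∣ (𝔭 i) (𝔮 (toℕ α)) 𝔭i𝔮α∣)

  encInstr-denominators≢0 : ∀ i (ι : Instr n) → All (λ (_ , q) → q ≢ 0) (encInstr 𝔭 𝔮 i ι)
  encInstr-denominators≢0 i (INC α)   = prime≢0 (𝔭-prime i) ∷ []
  encInstr-denominators≢0 i (DEC α j) =
    ≢-nonZero⁻¹ _ {{m*n≢0 (𝔭 i) (𝔮 (toℕ α)) {{prime⇒nonZero (𝔭-prime i)}} {{prime⇒nonZero (𝔮-prime _)}}}}
    ∷ prime≢0 (𝔭-prime i) ∷ []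

  encProg-denominators≢0 : ∀ s (P : List (Instr n)) → All (λ (_ , q) → q ≢ 0) (encProg 𝔭 𝔮 s P)
  encProg-denominators≢0 s []      = []
  encProg-denominators≢0 s (ι ∷ P) = ++⁺ (encInstr-denominators≢0 s ι) (encProg-denominators≢0 (suc s) P)

  module _ (s : ℕ) (P : List (Instr n)) (nsl : NoSelfLoops (s , P)) where

    enc : State n → ℕ
    enc = encState 𝔭 𝔮

    encMachine-simulates : ∀ {st st′} → MStep (s , P) st st′ →
      FStep (encMachine 𝔭 𝔮 (s , P)) (enc st) (enc st′)
    encMachine-simulates {i , v} (inc {α = α} at-i) =
      encProg-step s P v nsl at-i (encInstr-inc i v α)
    encMachine-simulates {i , v} (dec-suc {α = α} {p} at-i vα≡1+m) =
      encProg-step s P v nsl at-i (encInstr-dec-suc i v α p vα≡1+m)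
    encMachine-simulates {i , v} (dec-zero {α = α} {p} at-i vα≡0) =
      encProg-step s P v nsl at-i (encInstr-dec-zero i v α p vα≡0)

    encMachine-halts : ∀ {i} (v : Vec ℕ n) → instrAt s P i ≡ nothing →
      ∀ y → ¬ FStep (encMachine 𝔭 𝔮 (s , P)) (enc (i , v)) y
    encMachine-halts v halts _ = blocked⇒¬FStep (encProg-blocked s P v nsl halts)

    MStep-progress : ∀ st → instrAt s P (proj₁ st) ≡ nothing ⊎ Σ (State n) (MStep (s , P) st)
    MStep-progress (i , v) with instrAt s P i in at-i
    ... | nothing      = inj₁ refl
    ... | just (INC α) = inj₂ (_ , inc at-i)
    ... | just (DEC α p) with lookup v α in vα
    ...   | zero  = inj₂ (_ , dec-zero at-i vα)
    ...   | suc m = inj₂ (_ , dec-suc at-i vα)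

    terminates⇔ : ∀ st → MTerminates (s , P) st ⇔ FTerminates (encMachine 𝔭 𝔮 (s , P)) (enc st)
    terminates⇔ st = mk⇔
      (λ ((i , v) , steps , halts) →
        enc (i , v) , gmap enc encMachine-simulates steps , encMachine-halts v halts)
      (λ (_ , steps , stuck) →
        simulation-reflects-halting enc encMachine-simulates MStep-progress
          (FStep-deterministic (encProg-denominators≢0 s P)) st steps stuck)

lemma6p2 : (𝔭 𝔮 : ℕ → ℕ) → PrimeSeqs 𝔭 𝔮 →
    (n : ℕ) (P : List (Instr n)) → NoSelfLoops (1 , P) →
    (v : Vec ℕ n) →
    MTerminates (1 , P) (1 , v) ⇔ FTerminates (encMachine 𝔭 𝔮 (1 , P)) (encState 𝔭 𝔮 (1 , v))
lemma6p2 𝔭 𝔮 primes n P nsl v = Encoding.terminates⇔ 𝔭 𝔮 primes 1 P nsl (1 , v)
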